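{- Let $p$ be an odd prime, $h\ge1$, $q=p^h$, $l>1$, and let $d$ be an integer with $0<d<2lh-1$, $\gcd(l,d)=1$ and $l+d$ odd. Then the presemifields $BH(q,l,d)$ and $BH(q,l,2l-d)$ are strongly isotopic.
   Context: Fix a nonsquare $\beta\in\mathbb{F}_{q^{2l}}$ and a nonzero $\omega\in\mathbb{F}_{q^{2l}}$ with $\omega+\omega^{q^l}=0$. For an integer $d$ with $\gcd(l,d)=1$ and $l+d$ odd, $BH(q,l,d)$ is $(\mathbb{F}_{q^{2l}},+,\ast_d)$ with $$x\ast_d y=x^{q^l}y+xy^{q^l}+\Big(\beta(x^{q^d}y+xy^{q^d})+\beta^{q^l}(x^{q^d}y+xy^{q^d})^{q^l}\Big)\omega,$$ where powers $x^{q^k}$ are interpreted via the Frobenius automorphism, i.e. with $k$ reduced modulo $2l$. Two presemifields $(\mathbb{F}_{p^n},+,\ast)$, $(\mathbb{F}_{p^n},+,\ast')$ are strongly isotopic if there exist $\mathbb{F}_p$-linear permutations $N,L$ with $L(x\ast y)=N(x)\ast'N(y)$ for all $x,y$. -}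

module Defs where

open import Level using (Level; _⊔_) renaming (suc to lsuc)
open import Data.Nat using (ℕ; zero; suc; _^_; NonZero)
open import Data.Integer using (ℤ; _%ℕ_; +_)
open import Data.Fin using (Fin)
open import Data.Product using (Σ; ∃; ∃₂; _×_)
open import Relation.Nullary using (¬_)
open import Relation.Binary.PropositionalEquality using (_≡_)
open import Algebra.Bundles using (CommutativeRing)

record FiniteField (c ℓ : Level) (n : ℕ) : Set (lsuc (c ⊔ ℓ)) where
  field
    commRing : CommutativeRing c ℓ
  open CommutativeRing commRing public
  field
    0≉1       : ¬ (0# ≈ 1#)
    inverse   : ∀ x → ¬ (x ≈ 0#) → ∃ λ y → x * y ≈ 1#
    enum      : Fin n → Carrier
    enum-inj  : ∀ i j → enum i ≈ enum j → i ≡ j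
    enum-surj : ∀ x → ∃ λ i → enum i ≈ x

-- k mod m for an integer k, with values in {0,…,m-1} (m > 0); m = 0 is unused.
_modℤ_ : ℤ → ℕ → ℕ
k modℤ zero    = 0
k modℤ (suc m) = k %ℕ suc m

module _ {c ℓ : Level} {n : ℕ} (F : FiniteField c ℓ n) where
  open FiniteField F

  pow : Carrier → ℕ → Carrier
  pow x zero    = 1#
  pow x (suc k) = x * pow x k

  -- x ↦ x^(q^k) for F = F_{q^{2l}}, with k reduced modulo 2l
  frob : (q l : ℕ) → ℤ → Carrier → Carrier
  frob q l k x = pow x (q ^ (k modℤ (2 Data.Nat.* l)))

  NonSquare : Carrier → Set (c ⊔ ℓ)
  NonSquare β = ¬ (∃ λ y → y * y ≈ β)

  BH : (q l : ℕ) (β ω : Carrier) (d : ℤ) → Carrier → Carrier → Carrier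
  BH q l β ω d x y =
    (frob q l (+ l) x * y + x * frob q l (+ l) y)
    + ((β * t + frob q l (+ l) β * frob q l (+ l) t) * ω)
    where
    t = frob q l d x * y + x * frob q l d y

  -- F_p-linear map (F has prime characteristic p): additive and respecting ≈
  Linear : (Carrier → Carrier) → Set (c ⊔ ℓ)
  Linear f = (∀ x y → x ≈ y → f x ≈ f y) × (∀ x y → f (x + y) ≈ f x + f y)

  Permutation : (Carrier → Carrier) → Set (c ⊔ ℓ)
  Permutation f = (∀ x y → f x ≈ f y → x ≈ y) × (∀ y → ∃ λ x → f x ≈ y)

  StronglyIsotopic : (Carrier → Carrier → Carrier) → (Carrier → Carrier → Carrier) → Set (c ⊔ ℓ)
  StronglyIsotopic _∗_ _∗′_ =
    ∃₂ λ (N L : Carrier → Carrier) →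
      Linear N × Permutation N × Linear L × Permutation L ×
      (∀ x y → L (x ∗ y) ≈ (N x ∗′ N y))

module Submission where

-- Let S x = x^(q^l), an involutive automorphism of F = F_(q^(2l)), and E x = x^(q^d), whose
-- inverse is x ↦ x^(q^(2l-d)). As p is odd, every z ∈ F splits uniquely as z = u + v with
-- S u = u and S v = -v. In x ∗_d y = (S x y + x S y) + (β t + S(β t)) ω, with
-- t = E x y + x E y, the first summand is S-fixed and, since S ω = -ω, the second is
-- S-anti-fixed. The S-fixed summand of E x ∗_(2l-d) E y is E applied to that of x ∗_d y, and the
-- anti-fixed summands coincide because E⁻¹(E x) E y + E x E⁻¹(E y) = t. Hence N = E and
-- L(u + v) = E u + v give the strong isotopy. The powers of Frobenius are additive by the
-- freshman's dream and have period dividing 2lh by Fermat's little theorem x^(p^(2lh)) = x;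
-- the characteristic and Fermat's theorem come from reindexing sums and products over F.
-- The hypotheses on β, on gcd(l,d), on the parity of l + d and on the range of d only make BH
-- a presemifield; the isotopy does not use them.

open import Defs
open import Data.Nat as ℕ using (ℕ; zero; suc; NonZero)
import Data.Nat.Properties as ℕ
open import Data.Nat.Divisibility using (_∣_; _∤_; divides)
open import Data.Nat.Primality using (Prime; prime⇒nonZero)
import Data.Nat.Tactic.RingSolver as ℕ-Solver
open import Data.Nat.Combinatorics using (nCn≡1)
open import Data.Nat.DivMod using (m≡m%n+[m/n]*n)
open import Data.Integer as ℤ using (ℤ; +_)
import Data.Integer.Properties as ℤ
import Data.Integer.Tactic.RingSolver as ℤ-Solver
open import Data.Fin as Fin using (Fin; fromℕ)
import Data.Fin.Properties as Fin
import Data.Fin.Permutation as Permutation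
open import Data.Vec.Functional using (tail; init; last; replicate; removeAt)
open import Data.Product using (_,_; proj₁; proj₂)
open import Data.Sum using (inj₁; inj₂)
open import Function using (_∘_; case_of_)
open import Relation.Nullary using (¬_; yes; no; contradiction)
open import Relation.Binary.Definitions using (Decidable)
open import Relation.Binary.PropositionalEquality as ≡ using (_≡_; _≢_)
open import Algebra.Bundles using (CommutativeMonoid; CommutativeSemiring)
open import Algebra.Morphism.Structures using (module RingMorphisms)
import Algebra.Properties.CommutativeMonoid.Sum as MonoidSum
import Algebra.Properties.CommutativeSemiring.Binomial as Binomial
import Algebra.Properties.Monoid.Mult as MonoidMult
import Algebra.Properties.Ring as RingProperties
import Algebra.Properties.Semiring.Exp as SemiringExp
import Algebra.Properties.Semiring.Mult as SemiringMult
import Algebra.Properties.Semiring.Sum as SemiringSum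

module PrimeArithmetic where
  open import Data.Nat using (_+_; _*_; _∸_; _<_; _%_; _!)
  open import Data.Nat.Combinatorics using (_C_; nCk≡n!/k![n-k]!; k![n∸k]!∣n!)
  open import Data.Nat.Divisibility using (∣⇒≤; m∣m*n; m%n≡0⇒n∣m)
  open import Data.Nat.DivMod using (m/n*n≡m; m%n<n)
  open import Data.Nat.Primality using (euclidsLemma; prime⇒irreducible; prime⇒nonTrivial)
  open import Data.Integer using (∣_∣)
  open import Data.Integer.DivMod using (a≡a%ℕn+[a/ℕn]*n)
  open ≡ using (sym; cong)

  module _ {p} (p-prime : Prime p) where

    p∤m! : ∀ {m} → m < p → p ∤ m !
    p∤m! {zero}  _   p∣1  = ℕ.<⇒≱ (ℕ.nonTrivial⇒n>1 p {{prime⇒nonTrivial p-prime}}) (∣⇒≤ p∣1)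
    p∤m! {suc m} m<p p∣m! with euclidsLemma (suc m) (m !) p-prime p∣m!
    ... | inj₁ p∣1+m = ℕ.<⇒≱ m<p (∣⇒≤ p∣1+m)
    ... | inj₂ p∣m!  = p∤m! (ℕ.<-trans (ℕ.n<1+n m) m<p) p∣m!

    p∣pCk : ∀ {k} → 0 < k → k < p → p ∣ p C k
    p∣pCk {k} 0<k k<p with euclidsLemma (p C k) (k ! * (p ∸ k) !) p-prime p∣p!
      where
      instance _ = k ℕ.!* (p ∸ k) !≢0
      p!≡pCk*k!*[p∸k]! : p ! ≡ (p C k) * (k ! * (p ∸ k) !)
      p!≡pCk*k!*[p∸k]! = sym (≡.trans (cong (_* (k ! * (p ∸ k) !)) (nCk≡n!/k![n-k]! (ℕ.<⇒≤ k<p)))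
                                     (m/n*n≡m (k![n∸k]!∣n! (ℕ.<⇒≤ k<p))))
      n∣n! : ∀ n → .{{NonZero n}} → n ∣ n !
      n∣n! (suc n) = m∣m*n (n !)
      p∣p! : p ∣ (p C k) * (k ! * (p ∸ k) !)
      p∣p! = ≡.subst (p ∣_) p!≡pCk*k!*[p∸k]! (n∣n! p {{prime⇒nonZero p-prime}})
    ... | inj₁ p∣pCk = p∣pCk
    ... | inj₂ p∣k!*[p∸k]! with euclidsLemma (k !) ((p ∸ k) !) p-prime p∣k!*[p∸k]!
    ...   | inj₁ p∣k!     = contradiction p∣k! (p∤m! k<p)
    ...   | inj₂ p∣[p∸k]! = contradiction p∣[p∸k]! (p∤m! (ℕ.∸-monoʳ-< 0<k (ℕ.<⇒≤ k<p)))

  prime≢2⇒odd : ∀ {p} → Prime p → p ≢ 2 → p % 2 ≡ 1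
  prime≢2⇒odd {p} p-prime p≢2 with p % 2 in p%2≡r | m%n<n p 2
  ... | 0           | _ = case prime⇒irreducible p-prime (m%n≡0⇒n∣m p 2 p%2≡r) of λ where
    (inj₁ ())
    (inj₂ 2≡p) → contradiction (sym 2≡p) p≢2
  ... | 1           | _ = ≡.refl
  ... | suc (suc _) | ℕ.s≤s (ℕ.s≤s ())

  modℤ-+-divisible : ∀ m .{{_ : NonZero m}} (a b : ℤ) → a ℤ.+ b ≡ + m →
                     m ∣ a modℤ m + b modℤ m
  modℤ-+-divisible (suc m) a b a+b≡m = divides ∣ c ∣ (begin
    r + s                ≡⟨ cong ∣_∣ remainders ⟩
    ∣ c ℤ.* + M ∣        ≡⟨ ℤ.abs-* c (+ M) ⟩
    ∣ c ∣ * M            ∎)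
    where
    open ≡.≡-Reasoning
    M = suc m
    r = a ℤ.%ℕ M
    s = b ℤ.%ℕ M
    u = a ℤ./ℕ M
    v = b ℤ./ℕ M
    c = + 1 ℤ.- u ℤ.- v
    rearrange : ∀ r s u v M → r ℤ.+ s ≡ ((r ℤ.+ u ℤ.* M) ℤ.+ (s ℤ.+ v ℤ.* M)) ℤ.- (u ℤ.+ v) ℤ.* M
    rearrange = ℤ-Solver.solve-∀
    collect : ∀ u v M → M ℤ.- (u ℤ.+ v) ℤ.* M ≡ (+ 1 ℤ.- u ℤ.- v) ℤ.* M
    collect = ℤ-Solver.solve-∀
    remainders : + (r + s) ≡ c ℤ.* + M
    remainders = begin
      + r ℤ.+ + s                                                        ≡⟨ rearrange (+ r) (+ s) u v (+ M) ⟩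
      ((+ r ℤ.+ u ℤ.* + M) ℤ.+ (+ s ℤ.+ v ℤ.* + M)) ℤ.- (u ℤ.+ v) ℤ.* + M
        ≡⟨ cong (ℤ._- (u ℤ.+ v) ℤ.* + M)
                (≡.trans (sym (≡.cong₂ ℤ._+_ (a≡a%ℕn+[a/ℕn]*n a M) (a≡a%ℕn+[a/ℕn]*n b M))) a+b≡m) ⟩
      + M ℤ.- (u ℤ.+ v) ℤ.* + M                                          ≡⟨ collect u v (+ M) ⟩
      c ℤ.* + M                                                          ∎

open PrimeArithmetic

module CharacteristicP {c ℓ} (R : CommutativeSemiring c ℓ) where
  open CommutativeSemiring R
  open SemiringExp semiring using (_^_)
  open SemiringMult semiring using (_×_; ×-congʳ; ×-assoc-*; ×1-homo-*)
  open SemiringSum semiring using (sum; sum-init-last; sum-cong-≋; sum-replicate-zero)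
  open Binomial R using (binomialTerm; theorem)
  open import Relation.Binary.Reasoning.Setoid setoid

  binomialTerm-last : ∀ x y n → binomialTerm x y n (fromℕ n) ≈ x ^ n
  binomialTerm-last x y n rewrite Fin.toℕ-fromℕ n | nCn≡1 n | ℕ.n∸n≡0 n =
    trans (+-identityʳ _) (*-identityʳ _)

  ∣⇒×≈0 : ∀ {p m} → p × 1# ≈ 0# → ∀ x → p ∣ m → m × x ≈ 0#
  ∣⇒×≈0 {p} p×1≈0 x (divides k ≡.refl) = begin
    (k ℕ.* p) × x                 ≈⟨ ×-congʳ (k ℕ.* p) (*-identityˡ x) ⟨
    (k ℕ.* p) × (1# * x)          ≈⟨ ×-assoc-* (k ℕ.* p) 1# x ⟨
    ((k ℕ.* p) × 1#) * x          ≈⟨ *-congʳ (×1-homo-* k p) ⟩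
    ((k × 1#) * (p × 1#)) * x     ≈⟨ *-congʳ (*-congˡ p×1≈0) ⟩
    ((k × 1#) * 0#) * x           ≈⟨ *-congʳ (zeroʳ _) ⟩
    0# * x                        ≈⟨ zeroˡ x ⟩
    0#                            ∎

  freshmansDream : ∀ {p} → Prime p → p × 1# ≈ 0# → ∀ x y → (x + y) ^ p ≈ x ^ p + y ^ p
  freshmansDream {suc (suc m)} p-prime p×1≈0 x y = begin
    (x + y) ^ q                                           ≈⟨ theorem q x y ⟩
    t Fin.zero + sum (tail t)                             ≈⟨ +-congˡ (sum-init-last (tail t)) ⟩
    t Fin.zero + (sum (init (tail t)) + last (tail t))    ≈⟨ +-congˡ (+-cong (sum-cong-≋ middle) (binomialTerm-last x y q)) ⟩
    t Fin.zero + (sum (replicate (suc m) 0#) + x ^ q)     ≈⟨ +-congˡ (+-congʳ (sum-replicate-zero (suc m))) ⟩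
    t Fin.zero + (0# + x ^ q)                             ≈⟨ +-cong first (+-identityˡ _) ⟩
    y ^ q + x ^ q                                         ≈⟨ +-comm _ _ ⟩
    x ^ q + y ^ q                                         ∎
    where
    q = suc (suc m)
    t = binomialTerm x y q
    first : t Fin.zero ≈ y ^ q
    first = trans (+-identityʳ _) (*-identityˡ _)
    middle : ∀ j → init (tail t) j ≈ 0#
    middle j = ∣⇒×≈0 p×1≈0 _ (p∣pCk p-prime (ℕ.s≤s ℕ.z≤n) (ℕ.s≤s (Fin.inject₁ℕ< j)))

module _ {a ℓ} (M : CommutativeMonoid a ℓ) where
  open CommutativeMonoid M
  open MonoidSum M using (sum; sum-remove; sum-cong-≋; sum-replicate-zero)
  open import Relation.Binary.Reasoning.Setoid setoid

  sum-single : ∀ {m} (t : Fin m → Carrier) i → (∀ j → j ≢ i → t j ≈ ε) → sum t ≈ t i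
  sum-single {suc m} t i others≈ε = begin
    sum t                       ≈⟨ sum-remove t ⟩
    t i ∙ sum (removeAt t i)    ≈⟨ ∙-congˡ (sum-cong-≋ (λ j → others≈ε _ (Fin.punchInᵢ≢i i j))) ⟩
    t i ∙ sum (replicate m ε)   ≈⟨ ∙-congˡ (sum-replicate-zero m) ⟩
    t i ∙ ε                     ≈⟨ identityʳ (t i) ⟩
    t i                         ∎

module FiniteFieldProperties {c ℓ n} (F : FiniteField c ℓ n) where
  open FiniteField F
  open RingProperties ring using (+-identityʳ-unique)
  open SemiringExp semiring using (_^_)
  open SemiringMult semiring using (_×_)
  open MonoidSum +-commutativeMonoid using (∑-distrib-+; sum-replicate)
  open MonoidSum *-commutativeMonoid using () renaming
    (sum to product; ∑-distrib-+ to ∏-distrib-*; sum-cong-≋ to product-cong-≋; sum-replicate to product-replicate)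
  open import Relation.Binary.Reasoning.Setoid setoid

  index : Carrier → Fin n
  index x = proj₁ (enum-surj x)

  enum-index : ∀ x → enum (index x) ≈ x
  enum-index x = proj₂ (enum-surj x)

  index-cong : ∀ {x y} → x ≈ y → index x ≡ index y
  index-cong {x} {y} x≈y = enum-inj _ _ (trans (enum-index x) (trans x≈y (sym (enum-index y))))

  index-enum : ∀ i → index (enum i) ≡ i
  index-enum i = enum-inj _ _ (enum-index (enum i))

  infix 4 _≟_
  _≟_ : Decidable _≈_
  x ≟ y with index x Fin.≟ index y
  ... | yes i≡j = yes (trans (sym (enum-index x)) (trans (reflexive (≡.cong enum i≡j)) (enum-index y)))
  ... | no  i≢j = no (i≢j ∘ index-cong)

  module _ {a ℓ′} (M : CommutativeMonoid a ℓ′) where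
    private module M = CommutativeMonoid M
    open MonoidSum M using (sum; sum-permute; sum-cong-≋)

    sumAll : (Carrier → M.Carrier) → M.Carrier
    sumAll g = sum (g ∘ enum)

    sumAll-reindex : (g : Carrier → M.Carrier) → (∀ {x y} → x ≈ y → g x M.≈ g y) →
                     (f f⁻¹ : Carrier → Carrier) →
                     (∀ {x y} → x ≈ y → f x ≈ f y) → (∀ {x y} → x ≈ y → f⁻¹ x ≈ f⁻¹ y) →
                     (∀ x → f (f⁻¹ x) ≈ x) → (∀ x → f⁻¹ (f x) ≈ x) →
                     sumAll (g ∘ f) M.≈ sumAll g
    sumAll-reindex g g-cong f f⁻¹ f-cong f⁻¹-cong f∘f⁻¹≈id f⁻¹∘f≈id = M.trans
      (sum-cong-≋ (λ i → g-cong (sym (enum-index (f (enum i))))))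
      (M.sym (sum-permute (g ∘ enum) π))
      where
      σ τ : Fin n → Fin n
      σ i = index (f (enum i))
      τ i = index (f⁻¹ (enum i))
      σ∘τ≡id : ∀ i → σ (τ i) ≡ i
      σ∘τ≡id i = ≡.trans (index-cong (trans (f-cong (enum-index _)) (f∘f⁻¹≈id (enum i)))) (index-enum i)
      τ∘σ≡id : ∀ i → τ (σ i) ≡ i
      τ∘σ≡id i = ≡.trans (index-cong (trans (f⁻¹-cong (enum-index _)) (f⁻¹∘f≈id (enum i)))) (index-enum i)
      π : Permutation.Permutation n n
      π = Permutation.permutation σ τ σ∘τ≡id τ∘σ≡id

  inv : ∀ x → ¬ x ≈ 0# → Carrier
  inv x x≉0 = proj₁ (inverse x x≉0)

  *-inv : ∀ x (x≉0 : ¬ x ≈ 0#) → x * inv x x≉0 ≈ 1#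
  *-inv x x≉0 = proj₂ (inverse x x≉0)

  *-cancelʳ-nonzero : ∀ {x y z} → ¬ z ≈ 0# → x * z ≈ y * z → x ≈ y
  *-cancelʳ-nonzero {x} {y} {z} z≉0 xz≈yz = begin
    x                    ≈⟨ *-identityʳ x ⟨
    x * 1#               ≈⟨ *-congˡ (*-inv z z≉0) ⟨
    x * (z * z⁻¹)        ≈⟨ *-assoc x z z⁻¹ ⟨
    (x * z) * z⁻¹        ≈⟨ *-congʳ xz≈yz ⟩
    (y * z) * z⁻¹        ≈⟨ *-assoc y z z⁻¹ ⟩
    y * (z * z⁻¹)        ≈⟨ *-congˡ (*-inv z z≉0) ⟩
    y * 1#               ≈⟨ *-identityʳ y ⟩
    y                    ∎
    where z⁻¹ = inv z z≉0

  nonzero*y≈0⇒y≈0 : ∀ {x y} → ¬ x ≈ 0# → x * y ≈ 0# → y ≈ 0#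
  nonzero*y≈0⇒y≈0 {x} {y} x≉0 xy≈0 =
    *-cancelʳ-nonzero x≉0 (trans (*-comm y x) (trans xy≈0 (sym (zeroˡ x))))

  *-nonzero : ∀ {x y} → ¬ x ≈ 0# → ¬ y ≈ 0# → ¬ x * y ≈ 0#
  *-nonzero x≉0 y≉0 = y≉0 ∘ nonzero*y≈0⇒y≈0 x≉0

  ^≈0⇒≈0 : ∀ x k → x ^ k ≈ 0# → x ≈ 0#
  ^≈0⇒≈0 x zero    1≈0 = contradiction (sym 1≈0) 0≉1
  ^≈0⇒≈0 x (suc k) x^[1+k]≈0 with x ≟ 0#
  ... | yes x≈0 = x≈0
  ... | no  x≉0 = ^≈0⇒≈0 x k (nonzero*y≈0⇒y≈0 x≉0 x^[1+k]≈0)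

  product-nonzero : ∀ {m} (t : Fin m → Carrier) → (∀ i → ¬ t i ≈ 0#) → ¬ product t ≈ 0#
  product-nonzero {zero}  t t≉0 1≈0 = 0≉1 (sym 1≈0)
  product-nonzero {suc m} t t≉0 = *-nonzero (t≉0 Fin.zero) (product-nonzero (tail t) (t≉0 ∘ Fin.suc))

  -- Translation by 1 permutes F, so adding 1 to every summand of ∑ x leaves it unchanged.
  n×1≈0 : n × 1# ≈ 0#
  n×1≈0 = +-identityʳ-unique ∑x (n × 1#) (begin
    ∑x + n × 1#                           ≈⟨ +-congˡ (sum-replicate n) ⟨
    ∑x + ∑ (λ _ → 1#)                     ≈⟨ ∑-distrib-+ enum (λ _ → 1#) ⟨
    ∑ (_+ 1#)                             ≈⟨ sumAll-reindex +-commutativeMonoid (λ x → x) (λ x≈y → x≈y)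
                                               (_+ 1#) (_- 1#) +-congʳ +-congʳ [x-1]+1≈x [x+1]-1≈x ⟩
    ∑x                                    ∎)
    where
    ∑ = sumAll +-commutativeMonoid
    ∑x = ∑ (λ x → x)
    [x-1]+1≈x : ∀ x → (x - 1#) + 1# ≈ x
    [x-1]+1≈x x = trans (+-assoc x _ _) (trans (+-congˡ (-‿inverseˡ 1#)) (+-identityʳ x))
    [x+1]-1≈x : ∀ x → (x + 1#) - 1# ≈ x
    [x+1]-1≈x x = trans (+-assoc x _ _) (trans (+-congˡ (-‿inverseʳ 1#)) (+-identityʳ x))

  -- Multiplication by x ≉ 0 permutes F. Since the factor 0 would kill the product over F,
  -- φ replaces 0 by 1, and ψ, equal to x only at 0, restores the factor x this loses.
  private
    module Scaling {x} (x≉0 : ¬ x ≈ 0#) where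

      φ ψ : Carrier → Carrier
      φ a with a ≟ 0#
      ... | yes _ = 1#
      ... | no  _ = a
      ψ a with a ≟ 0#
      ... | yes _ = x
      ... | no  _ = 1#

      φ-cong : ∀ {a b} → a ≈ b → φ a ≈ φ b
      φ-cong {a} {b} a≈b with a ≟ 0# | b ≟ 0#
      ... | yes _   | yes _   = refl
      ... | yes a≈0 | no  b≉0 = contradiction (trans (sym a≈b) a≈0) b≉0
      ... | no  a≉0 | yes b≈0 = contradiction (trans a≈b b≈0) a≉0
      ... | no  _   | no  _   = a≈b

      φ-nonzero : ∀ a → ¬ φ a ≈ 0#
      φ-nonzero a with a ≟ 0#
      ... | yes _   = 0≉1 ∘ sym
      ... | no  a≉0 = a≉0

      φ[x*a]*ψa≈x*φa : ∀ a → φ (x * a) * ψ a ≈ x * φ a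
      φ[x*a]*ψa≈x*φa a with x * a ≟ 0# | a ≟ 0#
      ... | yes _    | yes _   = *-comm 1# x
      ... | yes xa≈0 | no  a≉0 = contradiction (nonzero*y≈0⇒y≈0 x≉0 xa≈0) a≉0
      ... | no  xa≉0 | yes a≈0 = contradiction (trans (*-congˡ a≈0) (zeroʳ x)) xa≉0
      ... | no  _    | no  _   = *-identityʳ _

      ∏ : (Carrier → Carrier) → Carrier
      ∏ = sumAll *-commutativeMonoid

      ∏ψ≈x : ∏ ψ ≈ x
      ∏ψ≈x = trans (sum-single *-commutativeMonoid (ψ ∘ enum) (index 0#) ψ≈1) (ψ≈x (enum-index 0#))
        where
        ψ≈1 : ∀ j → j ≢ index 0# → ψ (enum j) ≈ 1#
        ψ≈1 j j≢i with enum j ≟ 0#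
        ... | yes enum-j≈0 = contradiction (≡.trans (≡.sym (index-enum j)) (index-cong enum-j≈0)) j≢i
        ... | no  _        = refl
        ψ≈x : ∀ {a} → a ≈ 0# → ψ a ≈ x
        ψ≈x {a} a≈0 with a ≟ 0#
        ... | yes _   = refl
        ... | no  a≉0 = contradiction a≈0 a≉0

      ∏φ[x*_]≈∏φ : ∏ (φ ∘ (x *_)) ≈ ∏ φ
      ∏φ[x*_]≈∏φ = sumAll-reindex *-commutativeMonoid φ φ-cong (x *_) (x⁻¹ *_) *-congˡ *-congˡ
        x*[x⁻¹*a]≈a x⁻¹*[x*a]≈a
        where
        x⁻¹ = inv x x≉0
        x*[x⁻¹*a]≈a : ∀ a → x * (x⁻¹ * a) ≈ a
        x*[x⁻¹*a]≈a a = trans (sym (*-assoc x x⁻¹ a)) (trans (*-congʳ (*-inv x x≉0)) (*-identityˡ a))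
        x⁻¹*[x*a]≈a : ∀ a → x⁻¹ * (x * a) ≈ a
        x⁻¹*[x*a]≈a a = trans (sym (*-assoc x⁻¹ x a)) (trans (*-congʳ (trans (*-comm x⁻¹ x) (*-inv x x≉0))) (*-identityˡ a))

      x^n≈x : x ^ n ≈ x
      x^n≈x = sym (*-cancelʳ-nonzero (product-nonzero (φ ∘ enum) (φ-nonzero ∘ enum)) (begin
        x * ∏ φ                       ≈⟨ *-comm x (∏ φ) ⟩
        ∏ φ * x                       ≈⟨ *-cong ∏φ[x*_]≈∏φ ∏ψ≈x ⟨
        ∏ (φ ∘ (x *_)) * ∏ ψ          ≈⟨ ∏-distrib-* (φ ∘ (x *_) ∘ enum) (ψ ∘ enum) ⟨
        ∏ (λ a → φ (x * a) * ψ a)     ≈⟨ product-cong-≋ (φ[x*a]*ψa≈x*φa ∘ enum) ⟩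
        ∏ (λ a → x * φ a)             ≈⟨ ∏-distrib-* (λ _ → x) (φ ∘ enum) ⟩
        ∏ (λ _ → x) * ∏ φ             ≈⟨ *-congʳ (product-replicate n) ⟩
        x ^ n * ∏ φ                   ∎))

  fermat : ∀ x → x ^ n ≈ x
  fermat x with x ≟ 0#
  ... | no  x≉0 = Scaling.x^n≈x x≉0
  ... | yes x≈0 = x^m≈x n (index x)
    where
    x^m≈x : ∀ m → Fin m → x ^ m ≈ x
    x^m≈x (suc m) _ = trans (*-congʳ x≈0) (trans (zeroˡ _) (sym x≈0))

  pow≡^ : ∀ x k → pow F x k ≡ x ^ k
  pow≡^ x zero    = ≡.refl
  pow≡^ x (suc k) = ≡.cong (x *_) (pow≡^ x k)

module PrimePowerField {c ℓ p m} (p-prime : Prime p) (F : FiniteField c ℓ (p ℕ.^ m)) where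
  open FiniteField F
  open FiniteFieldProperties F
  open RingMorphisms rawRing rawRing using (IsRingHomomorphism)
  open RingProperties ring using (+-inverseʳ-unique)
  open SemiringExp semiring using (_^_; ^-congˡ; ^-assocʳ)
  open import Algebra.Properties.CommutativeSemiring.Exp commutativeSemiring using (^-distrib-*)
  open SemiringMult semiring using (_×_; ×1-homo-*)
  open MonoidMult *-monoid using (×-idem)
  open MonoidMult +-monoid using (×-homo-+)
  open CharacteristicP commutativeSemiring using (freshmansDream; ∣⇒×≈0)
  open import Relation.Binary.Reasoning.Setoid setoid
  private instance
    p-nonZero : NonZero p
    p-nonZero = prime⇒nonZero p-prime

  [p×1]^k≈p^k×1 : ∀ k → (p × 1#) ^ k ≈ (p ℕ.^ k) × 1#
  [p×1]^k≈p^k×1 zero    = sym (+-identityʳ 1#)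
  [p×1]^k≈p^k×1 (suc k) = trans (*-congˡ ([p×1]^k≈p^k×1 k)) (sym (×1-homo-* p (p ℕ.^ k)))

  p×1≈0 : p × 1# ≈ 0#
  p×1≈0 = ^≈0⇒≈0 (p × 1#) m (trans ([p×1]^k≈p^k×1 m) n×1≈0)

  1+1≉0 : p ≢ 2 → ¬ 1# + 1# ≈ 0#
  1+1≉0 p≢2 1+1≈0 = 0≉1 (begin
    0#                                   ≈⟨ p×1≈0 ⟨
    p × 1#                               ≡⟨ ≡.cong (_× 1#) p≡1+[p/2]*2 ⟩
    (1 ℕ.+ p/2 ℕ.* 2) × 1#               ≈⟨ ×-homo-+ 1# 1 (p/2 ℕ.* 2) ⟩
    1 × 1# + (p/2 ℕ.* 2) × 1#            ≈⟨ +-cong (+-identityʳ 1#) (∣⇒×≈0 2×1≈0 1# (divides p/2 ≡.refl)) ⟩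
    1# + 0#                              ≈⟨ +-identityʳ 1# ⟩
    1#                                   ∎)
    where
    p/2 = p ℕ./ 2
    p≡1+[p/2]*2 : p ≡ 1 ℕ.+ p/2 ℕ.* 2
    p≡1+[p/2]*2 = ≡.trans (m≡m%n+[m/n]*n p 2) (≡.cong (ℕ._+ p/2 ℕ.* 2) (prime≢2⇒odd p-prime p≢2))
    2×1≈0 : 2 × 1# ≈ 0#
    2×1≈0 = trans (+-congˡ (+-identityʳ 1#)) 1+1≈0

  σ : ℕ → Carrier → Carrier
  σ k x = pow F x (p ℕ.^ k)

  σ≈^ : ∀ k x → σ k x ≈ x ^ (p ℕ.^ k)
  σ≈^ k x = reflexive (pow≡^ x (p ℕ.^ k))

  σ-cong : ∀ k {x y} → x ≈ y → σ k x ≈ σ k y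
  σ-cong k {x} {y} x≈y = trans (σ≈^ k x) (trans (^-congˡ (p ℕ.^ k) x≈y) (sym (σ≈^ k y)))

  σ-∘ : ∀ a b x → σ a (σ b x) ≈ σ (b ℕ.+ a) x
  σ-∘ a b x = begin
    σ a (σ b x)                          ≈⟨ trans (σ≈^ a (σ b x)) (^-congˡ (p ℕ.^ a) (σ≈^ b x)) ⟩
    (x ^ (p ℕ.^ b)) ^ (p ℕ.^ a)          ≈⟨ ^-assocʳ x (p ℕ.^ b) (p ℕ.^ a) ⟩
    x ^ (p ℕ.^ b ℕ.* p ℕ.^ a)            ≡⟨ ≡.cong (x ^_) (ℕ.^-distribˡ-+-* p b a) ⟨
    x ^ (p ℕ.^ (b ℕ.+ a))                ≈⟨ σ≈^ (b ℕ.+ a) x ⟨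
    σ (b ℕ.+ a) x                        ∎

  σ-suc : ∀ k x → σ (suc k) x ≈ σ k (x ^ p)
  σ-suc k x = begin
    σ (suc k) x             ≈⟨ σ≈^ (suc k) x ⟩
    x ^ (p ℕ.* p ℕ.^ k)     ≈⟨ ^-assocʳ x p (p ℕ.^ k) ⟨
    (x ^ p) ^ (p ℕ.^ k)     ≈⟨ σ≈^ k (x ^ p) ⟨
    σ k (x ^ p)             ∎

  σ-+ : ∀ k x y → σ k (x + y) ≈ σ k x + σ k y
  σ-+ zero    x y = trans (*-identityʳ _) (sym (+-cong (*-identityʳ x) (*-identityʳ y)))
  σ-+ (suc k) x y = begin
    σ (suc k) (x + y)           ≈⟨ σ-suc k (x + y) ⟩
    σ k ((x + y) ^ p)           ≈⟨ σ-cong k (freshmansDream p-prime p×1≈0 x y) ⟩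
    σ k (x ^ p + y ^ p)         ≈⟨ σ-+ k (x ^ p) (y ^ p) ⟩
    σ k (x ^ p) + σ k (y ^ p)   ≈⟨ +-cong (σ-suc k x) (σ-suc k y) ⟨
    σ (suc k) x + σ (suc k) y   ∎

  σ-* : ∀ k x y → σ k (x * y) ≈ σ k x * σ k y
  σ-* k x y = trans (σ≈^ k (x * y)) (trans (^-distrib-* x y (p ℕ.^ k)) (sym (*-cong (σ≈^ k x) (σ≈^ k y))))

  σ-isRingHomomorphism : ∀ k → IsRingHomomorphism (σ k)
  σ-isRingHomomorphism k = record
    { isSemiringHomomorphism = record
      { isNearSemiringHomomorphism = record
        { +-isMonoidHomomorphism = record
          { isMagmaHomomorphism = record
            { isRelHomomorphism = record { cong = σ-cong k }
            ; homo = σ-+ k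
            }
          ; ε-homo = σ-0
          }
        ; *-homo = σ-* k
        }
      ; 1#-homo = trans (σ≈^ k 1#) (×-idem (*-identityˡ 1#) (p ℕ.^ k))
      }
    ; -‿homo = λ x → +-inverseʳ-unique (σ k x) (σ k (- x))
                 (trans (sym (σ-+ k x (- x))) (trans (σ-cong k (-‿inverseʳ x)) σ-0))
    }
    where
    instance _ = ℕ.m^n≢0 p k
    σ-0 : σ k 0# ≈ 0#
    σ-0 = trans (σ≈^ k 0#) (×-idem (zeroˡ 0#) (p ℕ.^ k))

  σ[m*k]≈id : ∀ k x → σ (m ℕ.* k) x ≈ x
  σ[m*k]≈id zero    x rewrite ℕ.*-zeroʳ m = *-identityʳ x
  σ[m*k]≈id (suc k) x rewrite ℕ.*-suc m k = begin
    σ (m ℕ.+ m ℕ.* k) x          ≈⟨ σ-∘ (m ℕ.* k) m x ⟨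
    σ (m ℕ.* k) (σ m x)          ≈⟨ σ-cong (m ℕ.* k) (trans (σ≈^ m x) (fermat x)) ⟩
    σ (m ℕ.* k) x                ≈⟨ σ[m*k]≈id k x ⟩
    x                            ∎

module FrobeniusOfBH {c ℓ p} (p-prime : Prime p) (h l : ℕ) .{{_ : NonZero l}}
                     (F : FiniteField c ℓ (p ℕ.^ (2 ℕ.* l ℕ.* h))) where
  open FiniteField F
  open PrimePowerField {m = 2 ℕ.* l ℕ.* h} p-prime F
  open RingMorphisms rawRing rawRing using (IsRingHomomorphism)
  open import Relation.Binary.Reasoning.Setoid setoid
  private instance
    2l-nonZero : NonZero (2 ℕ.* l)
    2l-nonZero = ℕ.m*n≢0 2 l

  Frob : ℤ → Carrier → Carrier
  Frob = frob F (p ℕ.^ h) l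

  exponent : ℤ → ℕ
  exponent z = h ℕ.* (z modℤ (2 ℕ.* l))

  Frob≡σ : ∀ z x → Frob z x ≡ σ (exponent z) x
  Frob≡σ z x = ≡.cong (pow F x) (ℕ.^-*-assoc p h (z modℤ (2 ℕ.* l)))

  Frob-isRingHomomorphism : ∀ z → IsRingHomomorphism (Frob z)
  Frob-isRingHomomorphism z = ≡.subst (λ e → IsRingHomomorphism (λ x → pow F x e))
    (≡.sym (ℕ.^-*-assoc p h (z modℤ (2 ℕ.* l)))) (σ-isRingHomomorphism (exponent z))

  Frob-∘ : ∀ z z′ x → Frob z (Frob z′ x) ≈ σ (exponent z′ ℕ.+ exponent z) x
  Frob-∘ z z′ x = begin
    Frob z (Frob z′ x)                    ≡⟨ Frob≡σ z (Frob z′ x) ⟩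
    σ (exponent z) (Frob z′ x)            ≡⟨ ≡.cong (σ (exponent z)) (Frob≡σ z′ x) ⟩
    σ (exponent z) (σ (exponent z′) x)    ≈⟨ σ-∘ (exponent z) (exponent z′) x ⟩
    σ (exponent z′ ℕ.+ exponent z) x      ∎

  Frob-comm : ∀ z z′ x → Frob z (Frob z′ x) ≈ Frob z′ (Frob z x)
  Frob-comm z z′ x = begin
    Frob z (Frob z′ x)                    ≈⟨ Frob-∘ z z′ x ⟩
    σ (exponent z′ ℕ.+ exponent z) x      ≡⟨ ≡.cong (λ e → σ e x) (ℕ.+-comm (exponent z′) (exponent z)) ⟩
    σ (exponent z ℕ.+ exponent z′) x      ≈⟨ Frob-∘ z′ z x ⟨
    Frob z′ (Frob z x)                    ∎

  Frob-inverse : ∀ z z′ → z ℤ.+ z′ ≡ + (2 ℕ.* l) → ∀ x → Frob z (Frob z′ x) ≈ x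
  Frob-inverse z z′ z+z′≡2l x with modℤ-+-divisible (2 ℕ.* l) z z′ z+z′≡2l
  ... | divides k r+r′≡k*2l = begin
    Frob z (Frob z′ x)                    ≈⟨ Frob-∘ z z′ x ⟩
    σ (exponent z′ ℕ.+ exponent z) x      ≡⟨ ≡.cong (λ e → σ e x) exponents ⟩
    σ (2 ℕ.* l ℕ.* h ℕ.* k) x             ≈⟨ σ[m*k]≈id k x ⟩
    x                                     ∎
    where
    r  = z modℤ (2 ℕ.* l)
    r′ = z′ modℤ (2 ℕ.* l)
    regroup : ∀ h k l → h ℕ.* (k ℕ.* (2 ℕ.* l)) ≡ 2 ℕ.* l ℕ.* h ℕ.* k
    regroup = ℕ-Solver.solve-∀
    exponents : h ℕ.* r′ ℕ.+ h ℕ.* r ≡ 2 ℕ.* l ℕ.* h ℕ.* k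
    exponents = ≡.trans (≡.sym (ℕ.*-distribˡ-+ h r′ r))
                (≡.trans (≡.cong (h ℕ.*_) (≡.trans (ℕ.+-comm r′ r) r+r′≡k*2l)) (regroup h k l))

module BHIsotopy {c ℓ n} (F : FiniteField c ℓ n) where
  open FiniteField F
  open FiniteFieldProperties F using (inv; *-inv; *-cancelʳ-nonzero)
  open RingMorphisms rawRing rawRing using (IsRingHomomorphism)
  open RingProperties ring using (-‿involutive; -‿distribʳ-*; -‿+-comm; ⁻¹-anti-homo‿-; +-inverseʳ-unique)
  open import Algebra.Properties.CommutativeSemigroup +-commutativeSemigroup using (interchange)
  open import Relation.Binary.Reasoning.Setoid setoid

  inverse⇒permutation : ∀ {f g : Carrier → Carrier} → (∀ {x y} → x ≈ y → g x ≈ g y) →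
                        (∀ x → f (g x) ≈ x) → (∀ x → g (f x) ≈ x) → Permutation F f
  inverse⇒permutation {f} {g} g-cong f∘g≈id g∘f≈id =
    (λ x y fx≈fy → trans (sym (g∘f≈id x)) (trans (g-cong fx≈fy) (g∘f≈id y))) , (λ y → g y , f∘g≈id y)

  polar : (Carrier → Carrier) → Carrier → Carrier → Carrier
  polar T x y = T x * y + x * T y

  traceTerm : (S : Carrier → Carrier) (β ω t : Carrier) → Carrier
  traceTerm S β ω t = (β * t + S β * S t) * ω

  -- x ∗_d y with x ↦ x^(q^l) abstracted to S and x ↦ x^(q^d) to T; BH F q l β ω d unfolds to
  -- bhProduct (frob F q l (+ l)) (frob F q l d) β ω.
  bhProduct : (S T : Carrier → Carrier) (β ω : Carrier) → Carrier → Carrier → Carrier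
  bhProduct S T β ω x y = polar S x y + traceTerm S β ω (polar T x y)

  module _ {S} (S-hom : IsRingHomomorphism S) (S-involutive : ∀ x → S (S x) ≈ x)
           (1+1≉0 : ¬ 1# + 1# ≈ 0#) where
    private module S = IsRingHomomorphism S-hom

    ½ : Carrier
    ½ = inv (1# + 1#) 1+1≉0

    ½*2≈1 : ½ * (1# + 1#) ≈ 1#
    ½*2≈1 = trans (*-comm ½ _) (*-inv _ 1+1≉0)

    ½*[x+x]≈x : ∀ x → ½ * (x + x) ≈ x
    ½*[x+x]≈x x = begin
      ½ * (x + x)                  ≈⟨ *-congˡ (+-cong (*-identityˡ x) (*-identityˡ x)) ⟨
      ½ * (1# * x + 1# * x)        ≈⟨ *-congˡ (distribʳ x 1# 1#) ⟨
      ½ * ((1# + 1#) * x)          ≈⟨ *-assoc ½ _ x ⟨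
      (½ * (1# + 1#)) * x          ≈⟨ *-congʳ ½*2≈1 ⟩
      1# * x                       ≈⟨ *-identityˡ x ⟩
      x                            ∎

    S½≈½ : S ½ ≈ ½
    S½≈½ = *-cancelʳ-nonzero 1+1≉0 (begin
      S ½ * (1# + 1#)              ≈⟨ *-congˡ (trans (S.+-homo 1# 1#) (+-cong S.1#-homo S.1#-homo)) ⟨
      S ½ * S (1# + 1#)            ≈⟨ S.*-homo ½ _ ⟨
      S (½ * (1# + 1#))            ≈⟨ S.⟦⟧-cong ½*2≈1 ⟩
      S 1#                         ≈⟨ S.1#-homo ⟩
      1#                           ≈⟨ ½*2≈1 ⟨
      ½ * (1# + 1#)                ∎)

    Fixed Anti : Carrier → Set ℓ
    Fixed u = S u ≈ u
    Anti  v = S v ≈ - v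

    fixedPart antiPart : Carrier → Carrier
    fixedPart z = ½ * (z + S z)
    antiPart  z = ½ * (z - S z)

    fixedPart-cong : ∀ {x y} → x ≈ y → fixedPart x ≈ fixedPart y
    fixedPart-cong x≈y = *-congˡ (+-cong x≈y (S.⟦⟧-cong x≈y))

    antiPart-cong : ∀ {x y} → x ≈ y → antiPart x ≈ antiPart y
    antiPart-cong x≈y = *-congˡ (+-cong x≈y (-‿cong (S.⟦⟧-cong x≈y)))

    fixedPart-+ : ∀ x y → fixedPart (x + y) ≈ fixedPart x + fixedPart y
    fixedPart-+ x y = begin
      ½ * ((x + y) + S (x + y))          ≈⟨ *-congˡ (+-congˡ (S.+-homo x y)) ⟩
      ½ * ((x + y) + (S x + S y))        ≈⟨ *-congˡ (interchange x y (S x) (S y)) ⟩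
      ½ * ((x + S x) + (y + S y))        ≈⟨ distribˡ ½ _ _ ⟩
      fixedPart x + fixedPart y          ∎

    antiPart-+ : ∀ x y → antiPart (x + y) ≈ antiPart x + antiPart y
    antiPart-+ x y = begin
      ½ * ((x + y) - S (x + y))          ≈⟨ *-congˡ (+-congˡ (trans (-‿cong (S.+-homo x y)) (sym (-‿+-comm (S x) (S y))))) ⟩
      ½ * ((x + y) + (- S x + - S y))    ≈⟨ *-congˡ (interchange x y (- S x) (- S y)) ⟩
      ½ * ((x - S x) + (y - S y))        ≈⟨ distribˡ ½ _ _ ⟩
      antiPart x + antiPart y            ∎

    fixedPart-fixed : ∀ z → Fixed (fixedPart z)
    fixedPart-fixed z = begin
      S (½ * (z + S z))                  ≈⟨ S.*-homo ½ _ ⟩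
      S ½ * S (z + S z)                  ≈⟨ *-cong S½≈½ (S.+-homo z (S z)) ⟩
      ½ * (S z + S (S z))                ≈⟨ *-congˡ (trans (+-congˡ (S-involutive z)) (+-comm (S z) z)) ⟩
      ½ * (z + S z)                      ∎

    antiPart-anti : ∀ z → Anti (antiPart z)
    antiPart-anti z = begin
      S (½ * (z - S z))                  ≈⟨ S.*-homo ½ _ ⟩
      S ½ * S (z - S z)                  ≈⟨ *-cong S½≈½ (S.+-homo z (- S z)) ⟩
      ½ * (S z + S (- S z))              ≈⟨ *-congˡ (+-congˡ (trans (S.-‿homo (S z)) (-‿cong (S-involutive z)))) ⟩
      ½ * (S z - z)                      ≈⟨ *-congˡ (⁻¹-anti-homo‿- z (S z)) ⟨
      ½ * - (z - S z)                    ≈⟨ -‿distribʳ-* ½ _ ⟨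
      - (½ * (z - S z))                  ∎

    fixedPart+antiPart : ∀ z → fixedPart z + antiPart z ≈ z
    fixedPart+antiPart z = begin
      ½ * (z + S z) + ½ * (z - S z)      ≈⟨ distribˡ ½ _ _ ⟨
      ½ * ((z + S z) + (z - S z))        ≈⟨ *-congˡ (interchange z (S z) z (- S z)) ⟩
      ½ * ((z + z) + (S z - S z))        ≈⟨ *-congˡ (trans (+-congˡ (-‿inverseʳ (S z))) (+-identityʳ _)) ⟩
      ½ * (z + z)                        ≈⟨ ½*[x+x]≈x z ⟩
      z                                  ∎

    fixedPart-of-fixed : ∀ {u} → Fixed u → fixedPart u ≈ u
    fixedPart-of-fixed {u} Su≈u = trans (*-congˡ (+-congˡ Su≈u)) (½*[x+x]≈x u)

    antiPart-of-anti : ∀ {v} → Anti v → antiPart v ≈ v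
    antiPart-of-anti {v} Sv≈-v = trans (*-congˡ (+-congˡ (trans (-‿cong Sv≈-v) (-‿involutive v)))) (½*[x+x]≈x v)

    fixedPart-of-anti : ∀ {v} → Anti v → fixedPart v ≈ 0#
    fixedPart-of-anti {v} Sv≈-v = trans (*-congˡ (trans (+-congˡ Sv≈-v) (-‿inverseʳ v))) (zeroʳ ½)

    antiPart-of-fixed : ∀ {u} → Fixed u → antiPart u ≈ 0#
    antiPart-of-fixed {u} Su≈u = trans (*-congˡ (trans (+-congˡ (-‿cong Su≈u)) (-‿inverseʳ u))) (zeroʳ ½)

    twist : (Carrier → Carrier) → Carrier → Carrier
    twist E z = E (fixedPart z) + antiPart z

    module _ {E : Carrier → Carrier} (E-cong : ∀ {x y} → x ≈ y → E x ≈ E y) where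

      twist-cong : ∀ {x y} → x ≈ y → twist E x ≈ twist E y
      twist-cong x≈y = +-cong (E-cong (fixedPart-cong x≈y)) (antiPart-cong x≈y)

      twist-split : ∀ {u v} → Fixed u → Anti v → twist E (u + v) ≈ E u + v
      twist-split {u} {v} Su≈u Sv≈-v = +-cong (E-cong fixedPart[u+v]≈u) antiPart[u+v]≈v
        where
        fixedPart[u+v]≈u : fixedPart (u + v) ≈ u
        fixedPart[u+v]≈u = begin
          fixedPart (u + v)              ≈⟨ fixedPart-+ u v ⟩
          fixedPart u + fixedPart v      ≈⟨ +-cong (fixedPart-of-fixed Su≈u) (fixedPart-of-anti Sv≈-v) ⟩
          u + 0#                         ≈⟨ +-identityʳ u ⟩
          u                              ∎
        antiPart[u+v]≈v : antiPart (u + v) ≈ v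
        antiPart[u+v]≈v = begin
          antiPart (u + v)               ≈⟨ antiPart-+ u v ⟩
          antiPart u + antiPart v        ≈⟨ +-cong (antiPart-of-fixed Su≈u) (antiPart-of-anti Sv≈-v) ⟩
          0# + v                         ≈⟨ +-identityˡ v ⟩
          v                              ∎

      twist-+ : (∀ x y → E (x + y) ≈ E x + E y) → ∀ x y → twist E (x + y) ≈ twist E x + twist E y
      twist-+ E-+ x y = begin
        E (fixedPart (x + y)) + antiPart (x + y)                         ≈⟨ +-cong (E-cong (fixedPart-+ x y)) (antiPart-+ x y) ⟩
        E (fixedPart x + fixedPart y) + (antiPart x + antiPart y)        ≈⟨ +-congʳ (E-+ _ _) ⟩
        (E (fixedPart x) + E (fixedPart y)) + (antiPart x + antiPart y)  ≈⟨ interchange _ _ _ _ ⟩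
        twist E x + twist E y                                            ∎

    twist-inverse : ∀ {E E′ : Carrier → Carrier} →
                    (∀ {x y} → x ≈ y → E x ≈ E y) → (∀ {x y} → x ≈ y → E′ x ≈ E′ y) →
                    (∀ x → S (E x) ≈ E (S x)) → (∀ x → E′ (E x) ≈ x) → ∀ z → twist E′ (twist E z) ≈ z
    twist-inverse {E} {E′} E-cong E′-cong S∘E≈E∘S E′∘E≈id z = begin
      twist E′ (E (fixedPart z) + antiPart z)    ≈⟨ twist-split E′-cong E[fixedPart]-fixed (antiPart-anti z) ⟩
      E′ (E (fixedPart z)) + antiPart z          ≈⟨ +-congʳ (E′∘E≈id (fixedPart z)) ⟩
      fixedPart z + antiPart z                   ≈⟨ fixedPart+antiPart z ⟩
      z                                          ∎
      where
      E[fixedPart]-fixed : Fixed (E (fixedPart z))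
      E[fixedPart]-fixed = trans (S∘E≈E∘S (fixedPart z)) (E-cong (fixedPart-fixed z))

    polar-fixed : ∀ x y → Fixed (polar S x y)
    polar-fixed x y = begin
      S (S x * y + x * S y)              ≈⟨ S.+-homo _ _ ⟩
      S (S x * y) + S (x * S y)          ≈⟨ +-cong (S.*-homo _ _) (S.*-homo _ _) ⟩
      S (S x) * S y + S x * S (S y)      ≈⟨ +-cong (*-congʳ (S-involutive x)) (*-congˡ (S-involutive y)) ⟩
      x * S y + S x * y                  ≈⟨ +-comm _ _ ⟩
      S x * y + x * S y                  ∎

    traceTerm-anti : ∀ β {ω} → ω + S ω ≈ 0# → ∀ t → Anti (traceTerm S β ω t)
    traceTerm-anti β {ω} ω+Sω≈0 t = begin
      S ((β * t + S β * S t) * ω)        ≈⟨ S.*-homo _ ω ⟩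
      S (β * t + S β * S t) * S ω        ≈⟨ *-cong (S.+-homo _ _) Sω≈-ω ⟩
      (S (β * t) + S (S β * S t)) * - ω  ≈⟨ *-congʳ (+-cong (S.*-homo β t) (S.*-homo (S β) (S t))) ⟩
      (S β * S t + S (S β) * S (S t)) * - ω
                                         ≈⟨ *-congʳ (+-congˡ (*-cong (S-involutive β) (S-involutive t))) ⟩
      (S β * S t + β * t) * - ω          ≈⟨ *-congʳ (+-comm _ _) ⟩
      (β * t + S β * S t) * - ω          ≈⟨ -‿distribʳ-* _ ω ⟨
      - ((β * t + S β * S t) * ω)        ∎
      where
      Sω≈-ω : S ω ≈ - ω
      Sω≈-ω = +-inverseʳ-unique ω (S ω) ω+Sω≈0

    traceTerm-cong : ∀ β ω {t t′} → t ≈ t′ → traceTerm S β ω t ≈ traceTerm S β ω t′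
    traceTerm-cong β ω t≈t′ = *-congʳ (+-cong (*-congˡ t≈t′) (*-congˡ (S.⟦⟧-cong t≈t′)))

    module _ {E E′} (E-hom : IsRingHomomorphism E) (E′-hom : IsRingHomomorphism E′)
             (S∘E≈E∘S : ∀ x → S (E x) ≈ E (S x)) (S∘E′≈E′∘S : ∀ x → S (E′ x) ≈ E′ (S x))
             (E∘E′≈id : ∀ x → E (E′ x) ≈ x) (E′∘E≈id : ∀ x → E′ (E x) ≈ x) where
      private
        module E  = IsRingHomomorphism E-hom
        module E′ = IsRingHomomorphism E′-hom

      E-polar : ∀ x y → E (polar S x y) ≈ polar S (E x) (E y)
      E-polar x y = begin
        E (S x * y + x * S y)              ≈⟨ E.+-homo _ _ ⟩
        E (S x * y) + E (x * S y)          ≈⟨ +-cong (E.*-homo _ _) (E.*-homo _ _) ⟩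
        E (S x) * E y + E x * E (S y)      ≈⟨ +-cong (*-congʳ (S∘E≈E∘S x)) (*-congˡ (S∘E≈E∘S y)) ⟨
        S (E x) * E y + E x * S (E y)      ∎

      polar-E′[E_] : ∀ x y → polar E′ (E x) (E y) ≈ polar E x y
      polar-E′[E_] x y = begin
        E′ (E x) * E y + E x * E′ (E y)    ≈⟨ +-cong (*-congʳ (E′∘E≈id x)) (*-congˡ (E′∘E≈id y)) ⟩
        x * E y + E x * y                  ≈⟨ +-comm _ _ ⟩
        E x * y + x * E y                  ∎

      twist-bhProduct : ∀ β {ω} → ω + S ω ≈ 0# → ∀ x y →
                        twist E (bhProduct S E β ω x y) ≈ bhProduct S E′ β ω (E x) (E y)
      twist-bhProduct β {ω} ω+Sω≈0 x y = begin
        twist E (polar S x y + traceTerm S β ω (polar E x y))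
          ≈⟨ twist-split E.⟦⟧-cong (polar-fixed x y) (traceTerm-anti β ω+Sω≈0 _) ⟩
        E (polar S x y) + traceTerm S β ω (polar E x y)
          ≈⟨ +-cong (E-polar x y) (traceTerm-cong β ω (sym (polar-E′[E_] x y))) ⟩
        polar S (E x) (E y) + traceTerm S β ω (polar E′ (E x) (E y))
          ∎

      bhProduct-stronglyIsotopic : ∀ β {ω} → ω + S ω ≈ 0# →
                                   StronglyIsotopic F (bhProduct S E β ω) (bhProduct S E′ β ω)
      bhProduct-stronglyIsotopic β ω+Sω≈0 =
        E , twist E ,
        ((λ _ _ → E.⟦⟧-cong) , E.+-homo) ,
        inverse⇒permutation E′.⟦⟧-cong E∘E′≈id E′∘E≈id ,
        ((λ _ _ → twist-cong E.⟦⟧-cong) , twist-+ E.⟦⟧-cong E.+-homo) ,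
        inverse⇒permutation (twist-cong E′.⟦⟧-cong)
          (twist-inverse E′.⟦⟧-cong E.⟦⟧-cong S∘E′≈E′∘S E∘E′≈id)
          (twist-inverse E.⟦⟧-cong E′.⟦⟧-cong S∘E≈E∘S E′∘E≈id) ,
        twist-bhProduct β ω+Sω≈0

open import Data.Nat using (ℕ; _^_; _*_; _+_; _∸_; _<_; _≤_; _%_)
open import Data.Nat.GCD using (gcd)
open import Data.Nat.Primality using (Prime)
open import Data.Integer using (+_; _-_)
open import Relation.Nullary using (¬_)
open import Relation.Binary.PropositionalEquality using (_≡_; _≢_)

lemma2p2 : ∀ {c ℓ} (p h l d : ℕ) → Prime p → p ≢ 2 → 1 ≤ h → 1 < l →
           0 < d → d < 2 * l * h ∸ 1 → gcd l d ≡ 1 → (l + d) % 2 ≡ 1 →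
           (F : FiniteField c ℓ (p ^ (2 * l * h))) →
           (β ω : FiniteField.Carrier F) →
           NonSquare F β →
           ¬ (FiniteField._≈_ F ω (FiniteField.0# F)) →
           FiniteField._≈_ F (FiniteField._+_ F ω (frob F (p ^ h) l (+ l) ω)) (FiniteField.0# F) →
           StronglyIsotopic F (BH F (p ^ h) l β ω (+ d))
                              (BH F (p ^ h) l β ω (+ (2 * l) - + d))
lemma2p2 p h l d p-prime p≢2 _ 1<l _ _ _ _ F β ω _ _ ω+ω^q^l≈0 =
  bhProduct-stronglyIsotopic
    (Frob-isRingHomomorphism (+ l)) (Frob-inverse (+ l) (+ l) l+l≡2l) (1+1≉0 p≢2)
    (Frob-isRingHomomorphism (+ d)) (Frob-isRingHomomorphism (+ (2 * l) - + d))
    (Frob-comm (+ l) (+ d)) (Frob-comm (+ l) (+ (2 * l) - + d))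
    (Frob-inverse (+ d) (+ (2 * l) - + d) d+[2l-d]≡2l)
    (Frob-inverse (+ (2 * l) - + d) (+ d) (≡.trans (ℤ.+-comm (+ (2 * l) - + d) (+ d)) d+[2l-d]≡2l))
    β ω+ω^q^l≈0
  where
  instance
    l-nonZero : NonZero l
    l-nonZero = ℕ.>-nonZero (ℕ.<-trans ℕ.z<s 1<l)
  open FrobeniusOfBH p-prime h l F
  open PrimePowerField {m = 2 * l * h} p-prime F using (1+1≉0)
  open BHIsotopy F using (bhProduct-stronglyIsotopic)
  l+l≡2l : + l ℤ.+ + l ≡ + (2 * l)
  l+l≡2l = ≡.cong (λ k → + (l + k)) (≡.sym (ℕ.+-identityʳ l))
  d+[2l-d]≡2l : + d ℤ.+ (+ (2 * l) - + d) ≡ + (2 * l)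
  d+[2l-d]≡2l = a+[b-a]≡b (+ d) (+ (2 * l))
    where
    a+[b-a]≡b : ∀ a b → a ℤ.+ (b - a) ≡ b
    a+[b-a]≡b = ℤ-Solver.solve-∀
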